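{- Let $f=c_1x_1^k+c_2x_2^k+\cdots+c_tx_t^k$ with $c_1,\ldots,c_t\in\mathbb{Z}$ and $k\geq 1$, and let $p$ be a prime not dividing any of $c_1,\ldots,c_t$. Then for every $n>k+1$, \[N_{p^n}\subseteq\{p^ka: a\in N_{p^{n-k}}\}.\]
   Context: For a positive integer $N$, $A_N$ is the set of $b\in\{0,1,\ldots,N-1\}$ such that $f(x_1,\ldots,x_t)\equiv b\pmod N$ has an integer solution. For $m\mid N$, $A_N(m)=\{b+jm: b\in A_m,\ 0\leq j<N/m\}$. For $n\geq 1$, $N_{p^n}=A_{p^n}(p^{n-1})\setminus A_{p^n}$. -}

module Defs where

open import Data.Nat as ℕ using (ℕ; _<_; _^_; _∸_)
open import Data.Nat.DivMod using (_/_)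
open import Data.Integer as ℤ using (ℤ; +_)
open import Data.Integer.Divisibility using (_∣_)
open import Data.Fin using (Fin)
open import Data.Product using (Σ; ∃; _×_)
open import Relation.Binary.PropositionalEquality using (_≡_)
open import Relation.Nullary using (¬_)

sumFin : (t : ℕ) → (Fin t → ℤ) → ℤ
sumFin ℕ.zero g = + 0
sumFin (ℕ.suc t) g = g Fin.zero ℤ.+ sumFin t (λ i → g (Fin.suc i))
  where import Data.Fin as Fin

diagForm : (t : ℕ) → (Fin t → ℤ) → ℕ → (Fin t → ℤ) → ℤ
diagForm t c k x = sumFin t (λ i → c i ℤ.* (x i ℤ.^ k))

A : (t : ℕ) → (Fin t → ℤ) → ℕ → (N : ℕ) → ℕ → Set
A t c k N b = b < N × Σ (Fin t → ℤ) (λ x → (+ N) ∣ (diagForm t c k x ℤ.- (+ b)))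

A⟨_⟩ : (m : ℕ) → (t : ℕ) → (Fin t → ℤ) → ℕ → (N : ℕ) → .{{ℕ.NonZero m}} → ℕ → Set
A⟨ m ⟩ t c k N e = Σ ℕ (λ b → Σ ℕ (λ j → A t c k m b × j < N / m × e ≡ b ℕ.+ j ℕ.* m))

Nset : (t : ℕ) → (Fin t → ℤ) → ℕ → (p : ℕ) → .{{ℕ.NonZero p}} → ℕ → ℕ → Set
Nset t c k p n e =
  A⟨ p ^ (n ∸ 1) ⟩ t c k (p ^ n) {{ℕ.m^n≢0 p (n ∸ 1)}} e × ¬ A t c k (p ^ n) e
  where import Data.Nat.Properties as ℕ

module Submission where

-- Let f = c₁x₁ᵏ + … + c_t x_tᵏ with k ≥ 1 and p ∤ cᵢ.  An element e of N_{pⁿ} is a residue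
-- e < pⁿ such that f ≡ e (mod pⁿ⁻¹) is solvable while f ≡ e (mod pⁿ) is not.
--
-- Take a solution x modulo pⁿ⁻¹.  If some xᵢ were a p-adic unit, Hensel's lemma in the variable xᵢ
-- would lift x to a solution modulo pⁿ: writing k = pᵞ·k' with p ∤ k', the derivative
-- k cᵢ xᵢᵏ⁻¹ has p-exponent γ, and a solution modulo pᴺ lifts as soon as N > 2γ, which holds
-- because 2γ ≤ k < n − 1.  Hence every xᵢ is divisible by p, x = p·y, f(x) = pᵏ f(y), and so
-- e = pᵏ·a with f(y) ≡ a (mod pⁿ⁻¹⁻ᵏ).  If a were solvable modulo pⁿ⁻ᵏ, scaling that solution
-- by p would make e solvable modulo pⁿ; so a ∈ N_{pⁿ⁻ᵏ}.

module DiagonalCongruences where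

  open import Defs
  open import Data.Nat as ℕ using (ℕ; zero; suc; NonZero; _≤_; _<_; z≤n; s≤s)
  import Data.Nat.Properties as ℕP
  import Data.Nat.Divisibility as ℕD
  open import Data.Nat.DivMod using (_/_; _%_; m*n/n≡m; m<n*o⇒m/o<n; m%n<n; m≡m%n+[m/n]*n)
  open import Data.Nat.Induction using (<-rec)
  open import Data.Nat.Primality
    using (Prime; euclidsLemma; prime⇒irreducible; prime⇒nonTrivial; prime⇒nonZero; ¬prime[1])
  open import Data.Nat.Coprimality using (Coprime; coprime-Bézout)
  open import Data.Nat.GCD using (module Bézout)
  import Data.Nat.Tactic.RingSolver as ℕSolver
  open import Data.Integer as ℤ using (ℤ; +_; -[1+_]; _+_; _*_; _^_; 1ℤ; 0ℤ; _-_; -_; ∣_∣)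
  import Data.Integer.Properties as ℤP
  import Data.Integer.Divisibility as U
  open import Data.Integer.Divisibility.Signed
    using (_∣_; divides; ∣-refl; ∣-trans; ∣m∣n⇒∣m+n; ∣m∣n⇒∣m-n; ∣n⇒∣m*n; ∣m⇒∣m*n;
           *-monoʳ-∣; *-cancelˡ-∣; ∣ᵤ⇒∣; ∣⇒∣ᵤ)
  open import Data.Integer.Tactic.RingSolver using (solve-∀)
  open import Data.Fin using (Fin; zero; suc)
  open import Data.Vec.Functional using (updateAt)
  open import Data.Product using (Σ; _,_; _×_; proj₁; proj₂)
  open import Data.Sum using (inj₁; inj₂)
  open import Data.Empty using (⊥-elim)
  open import Relation.Nullary using (¬_; yes; no)
  open import Relation.Binary.PropositionalEquality

  pos-^ : ∀ m n → + (m ℕ.^ n) ≡ (+ m) ^ n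
  pos-^ m zero = refl
  pos-^ m (suc n) = trans (ℤP.pos-* m (m ℕ.^ n)) (cong (+ m *_) (pos-^ m n))

  pos-affine : ∀ b j m → + (b ℕ.+ j ℕ.* m) ≡ + b + + j * + m
  pos-affine b j m = trans (ℤP.pos-+ b (j ℕ.* m)) (cong (_+_ (+ b)) (ℤP.pos-* j m))

  pos-^-* : ∀ p K a → + (p ℕ.^ K ℕ.* a) ≡ (+ p) ^ K * + a
  pos-^-* p K a = trans (ℤP.pos-* (p ℕ.^ K) a) (cong (_* + a) (pos-^ p K))

  ^-distribʳ-* : ∀ a b n → (a * b) ^ n ≡ a ^ n * b ^ n
  ^-distribʳ-* a b zero = refl
  ^-distribʳ-* a b (suc n) = trans (cong (a * b *_) (^-distribʳ-* a b n)) (interchange a b (a ^ n) (b ^ n))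
    where
    interchange : ∀ a b A B → a * b * (A * B) ≡ a * A * (b * B)
    interchange = solve-∀

  binomial-linear : ∀ x y k → Σ ℤ λ Q → (x + y) ^ suc k ≡ x ^ suc k + + suc k * x ^ k * y + y * y * Q
  binomial-linear x y zero = 0ℤ , base x y
    where
    base : ∀ x y → (x + y) * 1ℤ ≡ x * 1ℤ + + 1 * 1ℤ * y + y * y * 0ℤ
    base = solve-∀
  binomial-linear x y (suc k) with binomial-linear x y k
  ... | Q , expand = x * Q + + suc k * x ^ k + y * Q , (begin
      (x + y) * (x + y) ^ suc k                              ≡⟨ cong ((x + y) *_) expand ⟩
      (x + y) * (x * x ^ k + + suc k * x ^ k * y + y * y * Q) ≡⟨ step x y (x ^ k) (+ suc k) Q ⟩
      _                                                      ∎)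
    where
    open ≡-Reasoning
    step : ∀ x y X K Q → (x + y) * (x * X + K * X * y + y * y * Q)
                       ≡ x * (x * X) + (1ℤ + K) * (x * X) * y + y * y * (x * Q + K * X + y * Q)
    step = solve-∀

  diagForm-updateAt : ∀ t c k (x : Fin t → ℤ) i (g : ℤ → ℤ) →
    diagForm t c k (updateAt x i g) ≡ diagForm t c k x + c i * (g (x i) ^ k - x i ^ k)
  diagForm-updateAt (suc t) c k x zero g = swap (c zero) (g (x zero) ^ k) (x zero ^ k) _
    where
    swap : ∀ c G X S → c * G + S ≡ (c * X + S) + c * (G - X)
    swap = solve-∀
  diagForm-updateAt (suc t) c k x (suc i) g = begin
    c zero * x zero ^ k + diagForm t (λ j → c (suc j)) k (updateAt (λ j → x (suc j)) i g)
      ≡⟨ cong (λ w → c zero * x zero ^ k + w) (diagForm-updateAt t (λ j → c (suc j)) k (λ j → x (suc j)) i g) ⟩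
    c zero * x zero ^ k + (diagForm t (λ j → c (suc j)) k (λ j → x (suc j)) + c (suc i) * (g (x (suc i)) ^ k - x (suc i) ^ k))
      ≡⟨ ℤP.+-assoc (c zero * x zero ^ k) (diagForm t (λ j → c (suc j)) k (λ j → x (suc j))) _ ⟨
    _ ∎
    where open ≡-Reasoning

  diagForm-shift : ∀ t c k (x : Fin t → ℤ) i y → Σ ℤ λ Q →
    diagForm t c (suc k) (updateAt x i (_+ y))
      ≡ diagForm t c (suc k) x + c i * (+ suc k * x i ^ k * y + y * y * Q)
  diagForm-shift t c k x i y with binomial-linear (x i) y k
  ... | Q , expand = Q , (begin
    diagForm t c (suc k) (updateAt x i (_+ y))
      ≡⟨ diagForm-updateAt t c (suc k) x i (_+ y) ⟩
    F + c i * ((x i + y) ^ suc k - x i ^ suc k)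
      ≡⟨ cong (λ w → F + c i * (w - x i ^ suc k)) expand ⟩
    F + c i * ((x i ^ suc k + L + y * y * Q) - x i ^ suc k)
      ≡⟨ cong (λ w → F + c i * w) (cancel (x i ^ suc k) L (y * y * Q)) ⟩
    F + c i * (L + y * y * Q) ∎)
    where
    open ≡-Reasoning
    F L : ℤ
    F = diagForm t c (suc k) x
    L = + suc k * x i ^ k * y
    cancel : ∀ X L R → (X + L + R) - X ≡ L + R
    cancel = solve-∀

  diagForm-scale : ∀ t c k (x y : Fin t → ℤ) P → (∀ i → x i ≡ y i * P) →
    diagForm t c k x ≡ P ^ k * diagForm t c k y
  diagForm-scale zero c k x y P x≡yP = sym (ℤP.*-zeroʳ (P ^ k))
  diagForm-scale (suc t) c k x y P x≡yP = begin
    c zero * x zero ^ k + diagForm t (λ j → c (suc j)) k (λ j → x (suc j))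
      ≡⟨ cong₂ (λ u w → c zero * u + w)
           (trans (cong (_^ k) (x≡yP zero)) (^-distribʳ-* (y zero) P k))
           (diagForm-scale t (λ j → c (suc j)) k (λ j → x (suc j)) (λ j → y (suc j)) P (λ j → x≡yP (suc j))) ⟩
    c zero * (y zero ^ k * P ^ k) + P ^ k * diagForm t (λ j → c (suc j)) k (λ j → y (suc j))
      ≡⟨ factor (c zero) (y zero ^ k) (P ^ k) _ ⟩
    P ^ k * diagForm (suc t) c k y ∎
    where
    open ≡-Reasoning
    factor : ∀ c Y P S → c * (Y * P) + P * S ≡ P * (c * Y + S)
    factor = solve-∀

  -- 2n ≤ 2ⁿ; this bounds the exponent of a prime dividing k by k/2.
  2*n≤2^n : ∀ n → 2 ℕ.* n ≤ 2 ℕ.^ n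
  2*n≤2^n zero = z≤n
  2*n≤2^n (suc zero) = s≤s (s≤s z≤n)
  2*n≤2^n (suc (suc n)) = ℕP.≤-trans (ℕP.*-monoʳ-≤ 2 (ℕP.≤-trans (ℕP.m≤m+n (suc (suc n)) n) (ℕP.≤-reflexive (double n))))
                                     (ℕP.*-monoʳ-≤ 2 (2*n≤2^n (suc n)))
    where
    double : ∀ n → suc (suc n) ℕ.+ n ≡ 2 ℕ.* suc n
    double = ℕSolver.solve-∀

  pos-bézout : ∀ a b c d → 1 ℕ.+ a ℕ.* b ≡ c ℕ.* d → 1ℤ + + a * + b ≡ + c * + d
  pos-bézout a b c d e = trans (cong (_+_ 1ℤ) (sym (ℤP.pos-* a b))) (trans (cong +_ e) (ℤP.pos-* c d))

  bézout⇒inverse₁ : ∀ A y x P → 1ℤ + y * A ≡ x * P → A * (- y) - 1ℤ ≡ (- x) * P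
  bézout⇒inverse₁ A y x P e = trans (negate A y) (trans (cong -_ e) (ℤP.neg-distribˡ-* x P))
    where
    negate : ∀ A y → A * (- y) - 1ℤ ≡ - (1ℤ + y * A)
    negate = solve-∀

  bézout⇒inverse₂ : ∀ A y x P → 1ℤ + x * P ≡ y * A → A * y - 1ℤ ≡ x * P
  bézout⇒inverse₂ A y x P e = trans (cong (_- 1ℤ) (trans (ℤP.*-comm A y) (sym e))) (cancel x P)
    where
    cancel : ∀ x P → (1ℤ + x * P) - 1ℤ ≡ x * P
    cancel = solve-∀

  PFactorisation : ℕ → ℕ → Set
  PFactorisation p k = Σ ℕ λ γ → Σ ℕ λ k' → k ≡ p ℕ.^ γ ℕ.* k' × ¬ (p ℕD.∣ k')

  Solvable : (t : ℕ) → (Fin t → ℤ) → ℕ → ℤ → ℤ → Set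
  Solvable t c k M E = Σ (Fin t → ℤ) λ x → M ∣ diagForm t c k x - E

  lift-expansion : ∀ t c k (x : Fin t → ℤ) i A B K z d E →
    + suc k ≡ A * K → diagForm t c (suc k) x - E ≡ d * (A * B) →
    Σ ℤ λ W → diagForm t c (suc k) (updateAt x i (_+ B * z)) - E
                ≡ (A * B) * (d + c i * K * x i ^ k * z) + (B * B) * W
  lift-expansion t c k x i A B K z d E k+1≡ fx-E≡ with diagForm-shift t c k x i (B * z)
  ... | Q , shift = c i * z * z * Q , (begin
    diagForm t c (suc k) (updateAt x i (_+ B * z)) - E
      ≡⟨ cong (_- E) shift ⟩
    (F + c i * (+ suc k * X * (B * z) + B * z * (B * z) * Q)) - E
      ≡⟨ cong (λ w → (F + c i * (w * X * (B * z) + B * z * (B * z) * Q)) - E) k+1≡ ⟩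
    (F + c i * (A * K * X * (B * z) + B * z * (B * z) * Q)) - E
      ≡⟨ regroup F E (c i) A K X B z Q ⟩
    (F - E) + (A * B) * (c i * K * X * z) + (B * B) * (c i * z * z * Q)
      ≡⟨ cong (λ w → w + (A * B) * (c i * K * X * z) + (B * B) * (c i * z * z * Q)) fx-E≡ ⟩
    d * (A * B) + (A * B) * (c i * K * X * z) + (B * B) * (c i * z * z * Q)
      ≡⟨ collect d (A * B) (c i * K * X * z) ((B * B) * (c i * z * z * Q)) ⟩
    (A * B) * (d + c i * K * X * z) + (B * B) * (c i * z * z * Q) ∎)
    where
    open ≡-Reasoning
    F X : ℤ
    F = diagForm t c (suc k) x
    X = x i ^ k
    regroup : ∀ F E c A K X B z Q →
      (F + c * (A * K * X * (B * z) + B * z * (B * z) * Q)) - E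
        ≡ (F - E) + (A * B) * (c * K * X * z) + (B * B) * (c * z * z * Q)
    regroup = solve-∀
    collect : ∀ d N U R → d * N + N * U + R ≡ N * (d + U) + R
    collect = solve-∀

  ∣-shift : ∀ {M} F B {E} J → E ≡ B + J * M → M ∣ F - B → M ∣ F - E
  ∣-shift {M} F B J refl M∣F-B = subst (M ∣_) (regroup F B J M) (∣m∣n⇒∣m-n M∣F-B (∣n⇒∣m*n J ∣-refl))
    where
    regroup : ∀ F B J M → (F - B) - J * M ≡ F - (B + J * M)
    regroup = solve-∀

  ∣-unshift : ∀ {M} F B {E} J → E ≡ B + J * M → M ∣ F - E → M ∣ F - B
  ∣-unshift {M} F B J refl M∣F-E = subst (M ∣_) (regroup F B J M) (∣m∣n⇒∣m+n M∣F-E (∣n⇒∣m*n J ∣-refl))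
    where
    regroup : ∀ F B J M → (F - (B + J * M)) + J * M ≡ F - B
    regroup = solve-∀

  A⟨⟩-elim : ∀ t c k m q e .{{_ : NonZero m}} → A⟨ m ⟩ t c k (q ℕ.* m) e →
    e < q ℕ.* m × Solvable t c k (+ m) (+ e)
  A⟨⟩-elim t c k m q e (b , j , (b<m , x , m∣f-b) , j<qm/m , refl) =
    ℕP.≤-trans (ℕP.+-monoˡ-< (j ℕ.* m) b<m) (ℕP.*-monoˡ-≤ m j<q) ,
    x , ∣-shift (diagForm t c k x) (+ b) (+ j) (pos-affine b j m) (∣ᵤ⇒∣ m∣f-b)
    where
    j<q : j < q
    j<q = subst (j <_) (m*n/n≡m q m) j<qm/m

  A⟨⟩-intro : ∀ t c k m q e .{{_ : NonZero m}} → e < q ℕ.* m → Solvable t c k (+ m) (+ e) →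
    A⟨ m ⟩ t c k (q ℕ.* m) e
  A⟨⟩-intro t c k m q e e<qm (x , m∣f-e) =
    e % m , e / m ,
    (m%n<n e m , x , ∣⇒∣ᵤ (∣-unshift (diagForm t c k x) (+ (e % m)) (+ (e / m)) e≡ m∣f-e)) ,
    subst (e / m <_) (sym (m*n/n≡m q m)) (m<n*o⇒m/o<n e<qm) ,
    m≡m%n+[m/n]*n e m
    where
    e≡ : + e ≡ + (e % m) + + (e / m) * + m
    e≡ = trans (cong +_ (m≡m%n+[m/n]*n e m)) (pos-affine (e % m) (e / m) m)

  Nset-elim : ∀ t c k p .{{_ : NonZero p}} N e → Nset t c k p (suc N) e →
    e < p ℕ.^ suc N × Solvable t c k ((+ p) ^ N) (+ e) × ¬ Solvable t c k ((+ p) ^ suc N) (+ e)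
  Nset-elim t c k p N e (e∈A⟨⟩ , e∉A) with A⟨⟩-elim t c k (p ℕ.^ N) p e {{ℕP.m^n≢0 p N}} e∈A⟨⟩
  ... | e< , x , pᴺ∣ =
    e< , (x , subst (_∣ _) (pos-^ p N) pᴺ∣) ,
    λ (z , pᴺ⁺¹∣) → e∉A (e< , z , ∣⇒∣ᵤ (subst (_∣ _) (sym (pos-^ p (suc N))) pᴺ⁺¹∣))

  Nset-intro : ∀ t c k p .{{_ : NonZero p}} N e → e < p ℕ.^ suc N →
    Solvable t c k ((+ p) ^ N) (+ e) → ¬ Solvable t c k ((+ p) ^ suc N) (+ e) → Nset t c k p (suc N) e
  Nset-intro t c k p N e e< (x , pᴺ∣) ¬sol =
    A⟨⟩-intro t c k (p ℕ.^ N) p e {{ℕP.m^n≢0 p N}} e< (x , subst (_∣ _) (sym (pos-^ p N)) pᴺ∣) ,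
    λ (_ , z , pᴺ⁺¹∣) → ¬sol (z , subst (_∣ _) (pos-^ p (suc N)) (∣ᵤ⇒∣ pᴺ⁺¹∣))

  scale-solution : ∀ t c k P M A → Solvable t c k (P ^ M) A → Solvable t c k (P ^ (k ℕ.+ M)) (P ^ k * A)
  scale-solution t c k P M A (z , Pᴹ∣) =
    (λ i → z i * P) ,
    subst₂ _∣_ (sym (ℤP.^-distribˡ-+-* P k M))
      (trans (distrib (P ^ k) (diagForm t c k z) A)
             (cong (_- P ^ k * A) (sym (diagForm-scale t c k (λ i → z i * P) z P (λ i → refl)))))
      (*-monoʳ-∣ (P ^ k) Pᴹ∣)
    where
    distrib : ∀ a b c → a * (b - c) ≡ a * b - a * c
    distrib = solve-∀

  unscale : ∀ p .{{_ : NonZero p}} K M F e → (+ p) ^ (K ℕ.+ M) ∣ (+ p) ^ K * F - + e →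
    Σ ℕ λ a → e ≡ p ℕ.^ K ℕ.* a × (+ p) ^ M ∣ F - + a
  unscale p K M F e Pᴷ⁺ᴹ∣ =
    a , e≡ ,
    *-cancelˡ-∣ (P ^ K) {{Pᴷ≢0}}
      (subst₂ _∣_ (ℤP.^-distribˡ-+-* P K M)
                  (trans (cong (λ w → P ^ K * F - w) (pos-^-* p K a)) (distrib (P ^ K) F (+ a)))
                  (subst (λ w → P ^ (K ℕ.+ M) ∣ P ^ K * F - + w) e≡ Pᴷ⁺ᴹ∣))
    where
    P : ℤ
    P = + p
    Pᴷ≢0 : ℤ.NonZero (P ^ K)
    Pᴷ≢0 = subst ℤ.NonZero (pos-^ p K) (ℕP.m^n≢0 p K)
    Pᴷ∣e : P ^ K ∣ + e
    Pᴷ∣e = subst (P ^ K ∣_) (cancel (P ^ K * F) (+ e))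
             (∣m∣n⇒∣m-n (∣m⇒∣m*n F ∣-refl)
                        (∣-trans (divides (P ^ M) (trans (ℤP.^-distribˡ-+-* P K M) (ℤP.*-comm (P ^ K) (P ^ M)))) Pᴷ⁺ᴹ∣))
      where
      cancel : ∀ X E → X - (X - E) ≡ E
      cancel = solve-∀
    pᴷ∣e : p ℕ.^ K ℕD.∣ e
    pᴷ∣e = subst (ℕD._∣ e) (cong ∣_∣ (sym (pos-^ p K))) (∣⇒∣ᵤ Pᴷ∣e)
    a : ℕ
    a = ℕD.quotient pᴷ∣e
    e≡ : e ≡ p ℕ.^ K ℕ.* a
    e≡ = trans (ℕD._∣_.equality pᴷ∣e) (ℕP.*-comm a (p ℕ.^ K))
    distrib : ∀ a b c → a * b - a * c ≡ a * (b - c)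
    distrib = solve-∀

  exponent-split : ∀ k {n} → k ℕ.+ 1 < n → Σ ℕ λ M → n ≡ suc (k ℕ.+ suc M)
  exponent-split k k+1<n = M , trans (sym (proj₂ (ℕP.m≤n⇒∃[o]m+o≡n k+1<n))) (shape k M)
    where
    M : ℕ
    M = proj₁ (ℕP.m≤n⇒∃[o]m+o≡n k+1<n)
    shape : ∀ k M → suc (k ℕ.+ 1) ℕ.+ M ≡ suc (k ℕ.+ suc M)
    shape = ℕSolver.solve-∀

  module _ {p : ℕ} (pp : Prime p) where

    private
      instance
        p≢0 : NonZero p
        p≢0 = prime⇒nonZero pp
        p-nonTrivial : ℕ.NonTrivial p
        p-nonTrivial = prime⇒nonTrivial pp
      P : ℤ
      P = + p

    ∤-* : ∀ a b → ¬ (+ p U.∣ a) → ¬ (+ p U.∣ b) → ¬ (+ p U.∣ a * b)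
    ∤-* a b p∤a p∤b p∣ab with euclidsLemma ∣ a ∣ ∣ b ∣ pp (subst (p ℕD.∣_) (ℤP.abs-* a b) p∣ab)
    ... | inj₁ p∣a = p∤a p∣a
    ... | inj₂ p∣b = p∤b p∣b

    ∤-^ : ∀ a n → ¬ (+ p U.∣ a) → ¬ (+ p U.∣ a ^ n)
    ∤-^ a zero p∤a p∣1 = ¬prime[1] (subst Prime (ℕD.∣1⇒≡1 p∣1) pp)
    ∤-^ a (suc n) p∤a = ∤-* a (a ^ n) p∤a (∤-^ a n p∤a)

    ∤⇒coprime : ∀ {A} → ¬ (p ℕD.∣ A) → Coprime p A
    ∤⇒coprime p∤A (d∣p , d∣A) with prime⇒irreducible pp d∣p
    ... | inj₁ d≡1 = d≡1
    ... | inj₂ refl = ⊥-elim (p∤A d∣A)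

    inverse-ℕ : ∀ A → ¬ (p ℕD.∣ A) → Σ ℤ λ w → P ∣ + A * w - 1ℤ
    inverse-ℕ A p∤A with coprime-Bézout (∤⇒coprime p∤A)
    ... | Bézout.+- x y eq = - + y , divides (- + x) (bézout⇒inverse₁ (+ A) (+ y) (+ x) P (pos-bézout y A x p eq))
    ... | Bézout.-+ x y eq = + y , divides (+ x) (bézout⇒inverse₂ (+ A) (+ y) (+ x) P (pos-bézout x p y A eq))

    inverse : ∀ u → ¬ (P U.∣ u) → Σ ℤ λ v → P ∣ u * v - 1ℤ
    inverse (+ A) p∤u = inverse-ℕ A p∤u
    inverse -[1+ m ] p∤u with inverse-ℕ (suc m) p∤u
    ... | w , p∣ = - w , subst (P ∣_) (flip (+ suc m) w) p∣
      where
      flip : ∀ a w → a * w - 1ℤ ≡ (- a) * (- w) - 1ℤ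
      flip = solve-∀

    p-factorisation : ∀ k → 0 < k → PFactorisation p k
    p-factorisation = <-rec (λ k → 0 < k → PFactorisation p k) step
      where
      step : ∀ k → (∀ {q} → q < k → 0 < q → PFactorisation p q) → 0 < k → PFactorisation p k
      step k rec 0<k with p ℕD.∣? k
      ... | no p∤k = 0 , k , sym (ℕP.*-identityˡ k) , p∤k
      ... | yes (ℕD.divides zero refl) with () ← 0<k
      ... | yes p∣k@(ℕD.divides q@(suc _) refl) with rec (ℕD.quotient-< p∣k {{p-nonTrivial}} {{ℕ.>-nonZero 0<k}}) (s≤s z≤n)
      ...   | γ , k' , q≡ , p∤k' = suc γ , k' , trans (cong (ℕ._* p) q≡) (reassoc p (p ℕ.^ γ) k') , p∤k'
        where
        reassoc : ∀ p P k' → P ℕ.* k' ℕ.* p ≡ p ℕ.* P ℕ.* k'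
        reassoc = ℕSolver.solve-∀

    p-exponent-bound : ∀ {k γ k'} → k ≡ p ℕ.^ γ ℕ.* k' → ¬ (p ℕD.∣ k') → 2 ℕ.* γ ≤ k
    p-exponent-bound {γ = γ} {zero} k≡ p∤k' = ⊥-elim (p∤k' (ℕD.divides 0 refl))
    p-exponent-bound {γ = γ} {k'@(suc _)} refl p∤k' = begin
      2 ℕ.* γ          ≤⟨ 2*n≤2^n γ ⟩
      2 ℕ.^ γ          ≤⟨ ℕP.^-monoˡ-≤ γ (ℕ.nonTrivial⇒n>1 p) ⟩
      p ℕ.^ γ          ≤⟨ ℕP.m≤m*n (p ℕ.^ γ) k' ⟩
      p ℕ.^ γ ℕ.* k'   ∎
      where open ℕP.≤-Reasoning

    hensel : ∀ t c k (x : Fin t → ℤ) i γ k' → suc k ≡ p ℕ.^ γ ℕ.* k' → ¬ (p ℕD.∣ k') →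
      ¬ (P U.∣ c i) → ¬ (P U.∣ x i) → ∀ N → 2 ℕ.* γ < N → ∀ E →
      P ^ N ∣ diagForm t c (suc k) x - E → Solvable t c (suc k) (P ^ suc N) E
    hensel t c k x i γ k' k+1≡ p∤k' p∤cᵢ p∤xᵢ N 2γ<N E (divides d fx-E≡)
      with s , refl ← ℕP.m≤n⇒∃[o]m+o≡n 2γ<N
      = updateAt x i (_+ P ^ r * z) ,
        subst (P ^ suc N ∣_) (sym (proj₂ expansion))
          (∣m∣n⇒∣m+n (subst (P ^ suc N ∣_) (cong (_* (d + u * z)) Pᴺ≡) linear-term)
                      (∣m⇒∣m*n (proj₁ expansion) Pᴺ⁺¹∣P²ʳ))
      where
      -- split N = γ + r with r > γ, so that 2r ≥ N + 1
      r : ℕ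
      r = suc γ ℕ.+ s
      N≡γ+r : ∀ γ s → suc (2 ℕ.* γ) ℕ.+ s ≡ γ ℕ.+ (suc γ ℕ.+ s)
      N≡γ+r = ℕSolver.solve-∀
      2r≡ : ∀ γ s → (suc γ ℕ.+ s) ℕ.+ (suc γ ℕ.+ s) ≡ suc (suc (2 ℕ.* γ) ℕ.+ s) ℕ.+ s
      2r≡ = ℕSolver.solve-∀
      Pᴺ≡ : P ^ N ≡ P ^ γ * P ^ r
      Pᴺ≡ = trans (cong (P ^_) (N≡γ+r γ s)) (ℤP.^-distribˡ-+-* P γ r)
      k+1≡ℤ : + suc k ≡ P ^ γ * + k'
      k+1≡ℤ = trans (cong +_ k+1≡) (trans (ℤP.pos-* (p ℕ.^ γ) k') (cong (_* + k') (pos-^ p γ)))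
      -- the derivative coefficient u = c_i k' x_i^k is a p-adic unit
      u : ℤ
      u = c i * + k' * x i ^ k
      p∤u : ¬ (P U.∣ u)
      p∤u = ∤-* (c i * + k') (x i ^ k) (∤-* (c i) (+ k') p∤cᵢ p∤k') (∤-^ (x i) k p∤xᵢ)
      -- v inverts u modulo p; the correction z = −v·d kills the linear term modulo p
      v z : ℤ
      v = proj₁ (inverse u p∤u)
      z = - (v * d)
      expansion : Σ ℤ λ W → diagForm t c (suc k) (updateAt x i (_+ P ^ r * z)) - E
                              ≡ (P ^ γ * P ^ r) * (d + u * z) + (P ^ r * P ^ r) * W
      expansion = lift-expansion t c k x i (P ^ γ) (P ^ r) (+ k') z d E k+1≡ℤ (trans fx-E≡ (cong (d *_) Pᴺ≡))
      linear-term : P ^ suc N ∣ P ^ N * (d + u * z)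
      linear-term = subst (_∣ P ^ N * (d + u * z)) (ℤP.*-comm (P ^ N) P)
        (*-monoʳ-∣ (P ^ N) (subst (P ∣_) (cancel d u v) (∣n⇒∣m*n (- d) (proj₂ (inverse u p∤u)))))
        where
        cancel : ∀ d u v → (- d) * (u * v - 1ℤ) ≡ d + u * - (v * d)
        cancel = solve-∀
      Pᴺ⁺¹∣P²ʳ : P ^ suc N ∣ P ^ r * P ^ r
      Pᴺ⁺¹∣P²ʳ = subst (P ^ suc N ∣_) (trans (sym (ℤP.^-distribˡ-+-* P (suc N) s))
                                           (trans (cong (P ^_) (sym (2r≡ γ s))) (ℤP.^-distribˡ-+-* P r r)))
                   (∣m⇒∣m*n (P ^ s) ∣-refl)

    -- Hensel's lemma specialised to N > k+1: this exceeds twice the p-exponent of k+1.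
    lift-unit-solution : ∀ t c k (x : Fin t → ℤ) i → ¬ (P U.∣ c i) → ¬ (P U.∣ x i) →
      ∀ N → suc k < N → ∀ E → P ^ N ∣ diagForm t c (suc k) x - E → Solvable t c (suc k) (P ^ suc N) E
    lift-unit-solution t c k x i p∤cᵢ p∤xᵢ N k+1<N E with p-factorisation (suc k) (s≤s z≤n)
    ... | γ , k' , k+1≡ , p∤k' =
      hensel t c k x i γ k' k+1≡ p∤k' p∤cᵢ p∤xᵢ N (ℕP.≤-<-trans (p-exponent-bound {γ = γ} k+1≡ p∤k') k+1<N) E

    unliftable⇒divisible : ∀ t c k → (∀ i → ¬ (P U.∣ c i)) → ∀ N → suc k < N → ∀ E (x : Fin t → ℤ) →
      P ^ N ∣ diagForm t c (suc k) x - E → ¬ Solvable t c (suc k) (P ^ suc N) E → ∀ i → P ∣ x i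
    unliftable⇒divisible t c k p∤c N k+1<N E x Pᴺ∣ ¬sol i with p ℕD.∣? ∣ x i ∣
    ... | yes p∣xᵢ = ∣ᵤ⇒∣ p∣xᵢ
    ... | no p∤xᵢ = ⊥-elim (¬sol (lift-unit-solution t c k x i (p∤c i) p∤xᵢ N k+1<N E Pᴺ∣))

    descent : ∀ t c k → (∀ i → ¬ (P U.∣ c i)) → ∀ M e → 0 < M →
      Solvable t c (suc k) (P ^ (suc k ℕ.+ M)) (+ e) → ¬ Solvable t c (suc k) (P ^ suc (suc k ℕ.+ M)) (+ e) →
      Σ ℕ λ a → e ≡ p ℕ.^ suc k ℕ.* a × Solvable t c (suc k) (P ^ M) (+ a) × ¬ Solvable t c (suc k) (P ^ suc M) (+ a)
    descent t c k p∤c M e 0<M (x , Pᴷ⁺ᴹ∣) ¬sol = a , e≡ , (y , Pᴹ∣) , ¬sol-a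
      where
      K : ℕ
      K = suc k
      p∣x : ∀ i → P ∣ x i
      p∣x = unliftable⇒divisible t c k p∤c (K ℕ.+ M) (ℕP.m<m+n K 0<M) (+ e) x Pᴷ⁺ᴹ∣ ¬sol
      y : Fin t → ℤ
      y i = _∣_.quotient (p∣x i)
      fx≡ : diagForm t c K x ≡ P ^ K * diagForm t c K y
      fx≡ = diagForm-scale t c K x y P (λ i → _∣_.equality (p∣x i))
      unscaled : Σ ℕ λ a → e ≡ p ℕ.^ K ℕ.* a × P ^ M ∣ diagForm t c K y - + a
      unscaled = unscale p K M (diagForm t c K y) e (subst (λ w → P ^ (K ℕ.+ M) ∣ w - + e) fx≡ Pᴷ⁺ᴹ∣)
      a : ℕ
      a = proj₁ unscaled
      e≡ : e ≡ p ℕ.^ K ℕ.* a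
      e≡ = proj₁ (proj₂ unscaled)
      Pᴹ∣ : P ^ M ∣ diagForm t c K y - + a
      Pᴹ∣ = proj₂ (proj₂ unscaled)
      ¬sol-a : ¬ Solvable t c K (P ^ suc M) (+ a)
      ¬sol-a sol = ¬sol (subst₂ (λ n E → Solvable t c K (P ^ n) E) (ℕP.+-suc K M) (sym (trans (cong +_ e≡) (pos-^-* p K a)))
                                 (scale-solution t c K P (suc M) (+ a) sol))

    Nset-descent : ∀ t c k → (∀ i → ¬ (P U.∣ c i)) → ∀ M n → n ≡ suc (suc k ℕ.+ suc M) → ∀ e →
      Nset t c (suc k) p n e → Σ ℕ λ a → Nset t c (suc k) p (n ℕ.∸ suc k) a × e ≡ p ℕ.^ suc k ℕ.* a
    Nset-descent t c k p∤c M n refl e e∈N =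
      subst (λ n-K → Σ ℕ λ a → Nset t c K p n-K a × e ≡ p ℕ.^ K ℕ.* a) (sym (n-K≡ K M))
        (a , Nset-intro t c K p (suc M) a a< (proj₁ (proj₂ (proj₂ descended))) (proj₂ (proj₂ (proj₂ descended))) , e≡)
      where
      K : ℕ
      K = suc k
      n-K≡ : ∀ K M → suc (K ℕ.+ suc M) ℕ.∸ K ≡ suc (suc M)
      n-K≡ K M = trans (cong (ℕ._∸ K) (sym (ℕP.+-suc K (suc M)))) (ℕP.m+n∸m≡n K (suc (suc M)))
      facts : e < p ℕ.^ suc (K ℕ.+ suc M) × Solvable t c K (P ^ (K ℕ.+ suc M)) (+ e)
                                            × ¬ Solvable t c K (P ^ suc (K ℕ.+ suc M)) (+ e)
      facts = Nset-elim t c K p (K ℕ.+ suc M) e e∈N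
      descended : Σ ℕ λ a → e ≡ p ℕ.^ K ℕ.* a × Solvable t c K (P ^ suc M) (+ a)
                                              × ¬ Solvable t c K (P ^ suc (suc M)) (+ a)
      descended = descent t c k p∤c (suc M) e (s≤s z≤n) (proj₁ (proj₂ facts)) (proj₂ (proj₂ facts))
      a : ℕ
      a = proj₁ descended
      e≡ : e ≡ p ℕ.^ K ℕ.* a
      e≡ = proj₁ (proj₂ descended)
      a< : a < p ℕ.^ suc (suc M)
      a< = ℕP.*-cancelˡ-< (p ℕ.^ K) a (p ℕ.^ suc (suc M))
             (subst₂ _<_ e≡ (trans (cong (p ℕ.^_) (sym (ℕP.+-suc K (suc M)))) (ℕP.^-distribˡ-+-* p K (suc (suc M))))
                     (proj₁ facts))

open DiagonalCongruences using (exponent-split; Nset-descent)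

open import Defs
open import Data.Nat using (ℕ; _≤_; _<_; _+_; _*_; _^_; _∸_; suc)
open import Data.Nat.Primality using (Prime)
open import Data.Integer using (ℤ; +_)
open import Data.Integer.Divisibility using (_∣_)
open import Data.Fin using (Fin)
open import Data.Product using (Σ; _×_)
open import Relation.Binary.PropositionalEquality using (_≡_)
open import Relation.Nullary using (¬_)
open import Data.Nat using (zero)
open import Data.Product using (proj₁; proj₂)

lemma2p7 : (t : ℕ) (c : Fin t → ℤ) (k : ℕ) → 1 ≤ k →
    (p : ℕ) → (pp : Prime p) → (∀ i → ¬ ((+ p) ∣ c i)) →
    (n : ℕ) → k + 1 < n → (e : ℕ) →
    Nset t c k p {{Data.Nat.Primality.prime⇒nonZero pp}} n e →
    Σ ℕ (λ a → Nset t c k p {{Data.Nat.Primality.prime⇒nonZero pp}} (n ∸ k) a × e ≡ p ^ k * a)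
lemma2p7 t c zero () p pp p∤c n k+1<n
lemma2p7 t c (suc k) _ p pp p∤c n k+1<n =
  Nset-descent pp t c k p∤c (proj₁ n-shape) n (proj₂ n-shape)
  where
  n-shape : Σ ℕ λ M → n ≡ suc (suc k + suc M)
  n-shape = exponent-split (suc k) k+1<n
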